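{- For $s\in\{\mathrm{io},\mathrm{oi}\}$, the linear map $\phi_s:\mathbf{ASM}\to\mathbb K(q)$ defined, for every alternating sign matrix $\delta$ of size $n$, by $\phi_s(\mathbf F_{M^\delta})=\frac{q^{s(\delta)}}{n!}$ is an algebra morphism.
   Context: $\mathbb K$ is a field of characteristic zero. An alternating sign matrix (ASM) of size $n$ is an $n\times n$ matrix with entries in $\{0,1,-1\}$ such that in every row and every column the nonzero entries alternate in sign, the first and last nonzero entries being $1$. $\mathrm{oi}(\delta)$ (resp. $\mathrm{io}(\delta)$) is the number of entries of $\delta$ equal to $1$ (resp. $-1$). $M^\delta$ is the $0/1$ matrix with $M^\delta_{ij}=1$ iff $\delta_{ij}\neq0$. $\mathbf{ASM}$ is the vector space with basis $\{\mathbf F_{M^\delta}\}$, $\delta$ ranging over ASMs, with product: for ASMs of sizes $n_1,n_2$ and $M_1=M^{\delta_1}$, $M_2=M^{\delta_2}$, $\mathbf F_{M_1}\cdot\mathbf F_{M_2}=\sum\mathbf F_M$ over all matrices $M$ whose sequence of columns is a shuffle of the columns of $\begin{bmatrix}M_1\\ 0_{n_2\times n_1}\end{bmatrix}$ with those of $\begin{bmatrix}0_{n_1\times n_2}\\ M_2\end{bmatrix}$ (each such $M$ is of the form $M^\delta$ for an ASM $\delta$). -}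

module Defs where

open import Level using (Level; _⊔_; suc)
open import Algebra.Bundles using (CommutativeRing)
open import Relation.Nullary using (¬_)
open import Data.Nat as ℕ using (ℕ; zero; _<_)
open import Data.Nat using (_!)
open import Data.Integer as ℤ using (ℤ; +_; -[1+_])
open import Data.List using (List; []; _∷_; _++_; map; concatMap; length; replicate; foldr; [_])
open import Data.List.Relation.Unary.All using (All)
open import Data.Product using (_×_; _,_)
open import Data.Unit.Polymorphic using (⊤)

record Field (c ℓ : Level) : Set (suc (c ⊔ ℓ)) where
  field
    commutativeRing : CommutativeRing c ℓ
  open CommutativeRing commutativeRing public
  field
    _⁻¹     : Carrier → Carrier
    ⁻¹-inverse : ∀ x → ¬ (x ≈ 0#) → (x * (x ⁻¹)) ≈ 1#
    1≉0     : ¬ (1# ≈ 0#)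

module FieldOps {c ℓ : Level} (K : Field c ℓ) where
  open Field K

  fromℕ : ℕ → Carrier
  fromℕ zero = 0#
  fromℕ (ℕ.suc n) = 1# + fromℕ n

  CharZero : Set ℓ
  CharZero = ∀ n → ¬ (fromℕ (ℕ.suc n) ≈ 0#)

  -- Polynomials K[q] (coefficient lists, lowest degree first), which
  -- sit inside K(q) as a subring; equality up to trailing zeros.

  Poly : Set c
  Poly = List Carrier

  IsZeroP : Poly → Set (c ⊔ ℓ)
  IsZeroP = All (_≈ 0#)

  infix 4 _≈ₚ_
  _≈ₚ_ : Poly → Poly → Set (c ⊔ ℓ)
  []      ≈ₚ q       = IsZeroP q
  (a ∷ p) ≈ₚ []      = (a ≈ 0#) × IsZeroP p
  (a ∷ p) ≈ₚ (b ∷ r) = (a ≈ b) × (p ≈ₚ r)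

  infixl 6 _+ₚ_
  _+ₚ_ : Poly → Poly → Poly
  []      +ₚ q       = q
  (a ∷ p) +ₚ []      = a ∷ p
  (a ∷ p) +ₚ (b ∷ r) = (a + b) ∷ (p +ₚ r)

  _·ₚ_ : Carrier → Poly → Poly
  a ·ₚ p = map (a *_) p

  infixl 7 _*ₚ_
  _*ₚ_ : Poly → Poly → Poly
  []      *ₚ q = []
  (a ∷ p) *ₚ q = (a ·ₚ q) +ₚ (0# ∷ (p *ₚ q))

  oneₚ : Poly
  oneₚ = [ 1# ]

  qPow : ℕ → Poly
  qPow k = replicate k 0# ++ [ 1# ]

-- Matrices with integer entries, stored as the list of their columns
-- (each column a list of entries, top to bottom).  Entry δ_{ij} is the
-- i-th entry of the j-th column.

Mat : Set
Mat = List (List ℤ)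

-- i-th entry of a list (0 if out of range)
at : List ℤ → ℕ → ℤ
at []      _          = + 0
at (x ∷ l) zero       = x
at (x ∷ l) (ℕ.suc i)  = at l i

row : Mat → ℕ → List ℤ
row δ i = map (λ col → at col i) δ

nonzeros : List ℤ → List ℤ
nonzeros []               = []
nonzeros (+ zero ∷ l)     = nonzeros l
nonzeros (+ ℕ.suc k ∷ l)  = + ℕ.suc k ∷ nonzeros l
nonzeros (-[1+ k ] ∷ l)   = -[1+ k ] ∷ nonzeros l

data Sign : ℤ → Set where
  s0  : Sign (+ 0)
  s1  : Sign (+ 1)
  s-1 : Sign -[1+ 0 ]

data Alternating : List ℤ → Set where
  alt-one  : Alternating (+ 1 ∷ [])
  alt-step : ∀ {l} → Alternating l → Alternating (+ 1 ∷ -[1+ 0 ] ∷ l)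

ASMLine : List ℤ → Set
ASMLine l = All Sign l × Alternating (nonzeros l)

IsASM : Mat → Set
IsASM δ =
  All (λ col → length col ≡ length δ) δ
  × All ASMLine δ
  × (∀ i → i < length δ → ASMLine (row δ i))
  where open import Relation.Binary.PropositionalEquality using (_≡_)

size : Mat → ℕ
size δ = length δ

countEq : ℤ → List ℤ → ℕ
countEq v []      = 0
countEq v (x ∷ l) with x ℤ.≟ v
... | Relation.Nullary.yes _ = ℕ.suc (countEq v l)
... | Relation.Nullary.no  _ = countEq v l

oi : Mat → ℕ
oi δ = foldr (λ col acc → countEq (+ 1) col ℕ.+ acc) 0 δ

io : Mat → ℕ
io δ = foldr (λ col acc → countEq -[1+ 0 ] col ℕ.+ acc) 0 δ

data Stat : Set where
  statIo statOi : Stat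

stat : Stat → Mat → ℕ
stat statIo = io
stat statOi = oi

shuffles : {A : Set} → List A → List A → List (List A)
shuffles []       ys       = [ ys ]
shuffles (x ∷ xs) []       = [ x ∷ xs ]
shuffles (x ∷ xs) (y ∷ ys) =
  map (x ∷_) (shuffles xs (y ∷ ys)) ++ map (y ∷_) (shuffles (x ∷ xs) ys)

-- the columns of [M1 ; 0_{n2×n1}] and of [0_{n1×n2} ; M2]
upperBlock : Mat → Mat → Mat
upperBlock δ₁ δ₂ = map (λ col → col ++ replicate (size δ₂) (+ 0)) δ₁

lowerBlock : Mat → Mat → Mat
lowerBlock δ₁ δ₂ = map (λ col → replicate (size δ₁) (+ 0) ++ col) δ₂

-- the basis elements occurring in F_{δ₁} · F_{δ₂}
shuffleProduct : Mat → Mat → List Mat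
shuffleProduct δ₁ δ₂ = shuffles (upperBlock δ₁ δ₂) (lowerBlock δ₁ δ₂)

-- The algebra ASM over K: formal K-linear combinations of basis elements
-- F_δ (δ an ASM; δ ↦ M^δ is injective, so the basis may be indexed by δ),
-- given as lists of (coefficient, δ).

module ASMAlgebra {c ℓ : Level} (K : Field c ℓ) where
  open Field K
  open FieldOps K

  Comb : Set c
  Comb = List (Carrier × Mat)

  AllASM : Comb → Set c
  AllASM x = All (λ p → IsASM (Data.Product.proj₂ p)) x
    where import Data.Product

  basis : Mat → Comb
  basis δ = [ (1# , δ) ]

  infixl 7 _·A_
  _·A_ : Comb → Comb → Comb
  x ·A y = concatMap (λ { (a , δ₁) → concatMap (λ { (b , δ₂) →
             map (λ M → (a * b , M)) (shuffleProduct δ₁ δ₂) }) y }) x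

  unitA : Comb
  unitA = basis []

  φ : Stat → Comb → Poly
  φ s []             = []
  φ s ((a , δ) ∷ x)  = ((a * (fromℕ (size δ !) ⁻¹)) ·ₚ qPow (stat s δ)) +ₚ φ s x

-- φ_s is linear and the product of ASM is bilinear, so it suffices to treat
-- F_{δ₁} · F_{δ₂} with δ₁, δ₂ of sizes n₁, n₂. Each shuffle M is a permutation
-- of the columns of the block-diagonal matrix of δ₁ and δ₂, and the zero padding
-- changes no count of 1s or -1s, so M has size n₁ + n₂ and s(M) = s(δ₁) + s(δ₂).
-- There are (n₁ + n₂)! / (n₁! n₂!) shuffles, hence
-- φ_s(F_{δ₁} · F_{δ₂}) = (n₁ + n₂ choose n₁) q^{s(δ₁) + s(δ₂)} / (n₁ + n₂)!
--                     = (q^{s(δ₁)} / n₁!) (q^{s(δ₂)} / n₂!).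

module Submission where

open import Defs
open import Level using (Level)
open import Data.Product using (_×_; _,_)
open import Data.Nat as ℕ using (ℕ; zero; suc; _!; s≤s)
import Data.Nat.Properties as ℕ
open import Data.Nat.ListAction using (sum)
open import Data.Nat.ListAction.Properties using (sum-++; sum-↭)
open import Data.Nat.Tactic.RingSolver using (solve-∀)
open import Data.Integer as ℤ using (ℤ; +_; -[1+_])
open import Data.List using (List; []; _∷_; _++_; map; length; replicate; concatMap)
open import Data.List.Properties using (length-++; length-map; map-++; map-∘; map-cong; foldr-map)
open import Data.List.Relation.Unary.All as All using (All; []; _∷_)
import Data.List.Relation.Unary.All.Properties as All
open import Data.List.Relation.Binary.Permutation.Propositional using (_↭_; ↭-refl; ↭-sym; ↭-trans; prep)
import Data.List.Relation.Binary.Permutation.Propositional.Properties as ↭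
open import Function using (_∘_)
open import Relation.Binary.Bundles using (Setoid)
import Relation.Binary.Reasoning.Setoid as SetoidReasoning
open import Relation.Nullary using (¬_; yes; no; contradiction)
open import Relation.Binary.PropositionalEquality as ≡ using (_≡_; _≢_)

module ShuffleProduct where

  open import Data.Nat using (_+_; _*_)
  open import Relation.Binary.PropositionalEquality

  module _ {A : Set} where

    shuffles-↭ : (xs ys : List A) → All (_↭ xs ++ ys) (shuffles xs ys)
    shuffles-↭ []       ys       = ↭-refl ∷ []
    shuffles-↭ (x ∷ xs) []       = ↭-sym (↭.++-identityʳ (x ∷ xs)) ∷ []
    shuffles-↭ (x ∷ xs) (y ∷ ys) =
      All.++⁺ (All.map⁺ (All.map (prep x) (shuffles-↭ xs (y ∷ ys))))
              (All.map⁺ (All.map (λ p → ↭-trans (prep y p) (↭-sym (↭.shift y (x ∷ xs) ys)))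
                                 (shuffles-↭ (x ∷ xs) ys)))

    length-shuffles : (xs ys : List A) →
      length (shuffles xs ys) * (length xs !) * (length ys !) ≡ (length xs + length ys) !
    length-shuffles []       ys       = ℕ.+-identityʳ _
    length-shuffles (x ∷ xs) []       =
      trans (ℕ.*-identityʳ _) (trans (ℕ.+-identityʳ _) (cong _! (sym (ℕ.+-identityʳ (suc (length xs))))))
    length-shuffles (x ∷ xs) (y ∷ ys) = begin
        length (shuffles (x ∷ xs) (y ∷ ys)) * (suc m !) * (suc n !)
      ≡⟨ cong (λ k → k * (suc m !) * (suc n !)) length-split ⟩
        (a + b) * (suc m * (m !)) * (suc n * (n !))
      ≡⟨ regroup a b (m !) (n !) m n ⟩
        suc m * (a * (m !) * (suc n !)) + suc n * (b * (suc m !) * (n !))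
      ≡⟨ cong₂ (λ u v → suc m * u + suc n * v)
               (trans (length-shuffles xs (y ∷ ys)) (cong _! (ℕ.+-suc m n)))
               (length-shuffles (x ∷ xs) ys) ⟩
        suc m * (suc (m + n) !) + suc n * (suc (m + n) !)
      ≡⟨ pascal m n (suc (m + n) !) ⟩
        suc (suc (m + n)) * (suc (m + n) !)
      ≡⟨ cong (λ k → suc k !) (sym (ℕ.+-suc m n)) ⟩
        (suc m + suc n) !
      ∎
      where
      open ≡-Reasoning
      m n a b : ℕ
      m = length xs
      n = length ys
      a = length (shuffles xs (y ∷ ys))
      b = length (shuffles (x ∷ xs) ys)
      length-split : length (shuffles (x ∷ xs) (y ∷ ys)) ≡ a + b
      length-split = trans (length-++ (map (x ∷_) (shuffles xs (y ∷ ys))))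
                           (cong₂ _+_ (length-map _ (shuffles xs (y ∷ ys)))
                                      (length-map _ (shuffles (x ∷ xs) ys)))
      regroup : ∀ a b p q m n → (a + b) * (suc m * p) * (suc n * q)
              ≡ suc m * (a * p * (suc n * q)) + suc n * (b * (suc m * p) * q)
      regroup = solve-∀
      pascal : ∀ m n k → suc m * k + suc n * k ≡ suc (suc (m + n)) * k
      pascal = solve-∀

  countedEntry : Stat → ℤ
  countedEntry statIo = -[1+ 0 ]
  countedEntry statOi = + 1

  countedEntry≢0 : ∀ s → countedEntry s ≢ + 0
  countedEntry≢0 statIo ()
  countedEntry≢0 statOi ()

  countEq-++ : ∀ v xs ys → countEq v (xs ++ ys) ≡ countEq v xs + countEq v ys
  countEq-++ v []       ys = refl
  countEq-++ v (x ∷ xs) ys with x ℤ.≟ v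
  ... | yes _ = cong suc (countEq-++ v xs ys)
  ... | no  _ = countEq-++ v xs ys

  countEq-zeros : ∀ {v} → v ≢ + 0 → ∀ n → countEq v (replicate n (+ 0)) ≡ 0
  countEq-zeros v≢0 zero    = refl
  countEq-zeros {v} v≢0 (suc n) with + 0 ℤ.≟ v
  ... | yes 0≡v = contradiction (sym 0≡v) v≢0
  ... | no  _   = countEq-zeros v≢0 n

  stat-sum : ∀ s δ → stat s δ ≡ sum (map (countEq (countedEntry s)) δ)
  stat-sum statIo δ = sym (foldr-map _+_ (countEq -[1+ 0 ]) 0 δ)
  stat-sum statOi δ = sym (foldr-map _+_ (countEq (+ 1)) 0 δ)

  stat-++ : ∀ s δ₁ δ₂ → stat s (δ₁ ++ δ₂) ≡ stat s δ₁ + stat s δ₂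
  stat-++ s δ₁ δ₂ = begin
      stat s (δ₁ ++ δ₂)                         ≡⟨ stat-sum s (δ₁ ++ δ₂) ⟩
      sum (map count (δ₁ ++ δ₂))                ≡⟨ cong sum (map-++ count δ₁ δ₂) ⟩
      sum (map count δ₁ ++ map count δ₂)        ≡⟨ sum-++ (map count δ₁) (map count δ₂) ⟩
      sum (map count δ₁) + sum (map count δ₂)   ≡⟨ sym (cong₂ _+_ (stat-sum s δ₁) (stat-sum s δ₂)) ⟩
      stat s δ₁ + stat s δ₂                     ∎
    where
    open ≡-Reasoning
    count : List ℤ → ℕ
    count = countEq (countedEntry s)

  stat-↭ : ∀ s {δ₁ δ₂} → δ₁ ↭ δ₂ → stat s δ₁ ≡ stat s δ₂
  stat-↭ s {δ₁} {δ₂} p = begin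
      stat s δ₁                 ≡⟨ stat-sum s δ₁ ⟩
      sum (map count δ₁)        ≡⟨ sum-↭ (↭.map⁺ count p) ⟩
      sum (map count δ₂)        ≡⟨ sym (stat-sum s δ₂) ⟩
      stat s δ₂                 ∎
    where
    open ≡-Reasoning
    count : List ℤ → ℕ
    count = countEq (countedEntry s)

  stat-map : ∀ s (f : List ℤ → List ℤ) →
    (∀ col → countEq (countedEntry s) (f col) ≡ countEq (countedEntry s) col) →
    ∀ δ → stat s (map f δ) ≡ stat s δ
  stat-map s f f-preserves δ = begin
      stat s (map f δ)             ≡⟨ stat-sum s (map f δ) ⟩
      sum (map count (map f δ))    ≡⟨ cong sum (sym (map-∘ δ)) ⟩
      sum (map (count ∘ f) δ)      ≡⟨ cong sum (map-cong f-preserves δ) ⟩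
      sum (map count δ)            ≡⟨ sym (stat-sum s δ) ⟩
      stat s δ                     ∎
    where
    open ≡-Reasoning
    count : List ℤ → ℕ
    count = countEq (countedEntry s)

  stat-upperBlock : ∀ s δ₁ δ₂ → stat s (upperBlock δ₁ δ₂) ≡ stat s δ₁
  stat-upperBlock s δ₁ δ₂ = stat-map s _ padded δ₁
    where
    v : ℤ
    v = countedEntry s
    padded : ∀ col → countEq v (col ++ replicate (size δ₂) (+ 0)) ≡ countEq v col
    padded col = trans (countEq-++ v col _)
                       (trans (cong (λ k → countEq v col + k) (countEq-zeros (countedEntry≢0 s) (size δ₂)))
                              (ℕ.+-identityʳ _))

  stat-lowerBlock : ∀ s δ₁ δ₂ → stat s (lowerBlock δ₁ δ₂) ≡ stat s δ₂
  stat-lowerBlock s δ₁ δ₂ = stat-map s _ padded δ₂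
    where
    v : ℤ
    v = countedEntry s
    padded : ∀ col → countEq v (replicate (size δ₁) (+ 0) ++ col) ≡ countEq v col
    padded col = trans (countEq-++ v (replicate (size δ₁) (+ 0)) col)
                       (cong (_+ countEq v col) (countEq-zeros (countedEntry≢0 s) (size δ₁)))

  shuffleProduct-homogeneous : ∀ s δ₁ δ₂ →
    All (λ M → size M ≡ size δ₁ + size δ₂ × stat s M ≡ stat s δ₁ + stat s δ₂)
        (shuffleProduct δ₁ δ₂)
  shuffleProduct-homogeneous s δ₁ δ₂ = All.map degrees (shuffles-↭ upper lower)
    where
    upper lower : Mat
    upper = upperBlock δ₁ δ₂
    lower = lowerBlock δ₁ δ₂
    degrees : ∀ {M} → M ↭ upper ++ lower →
              size M ≡ size δ₁ + size δ₂ × stat s M ≡ stat s δ₁ + stat s δ₂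
    degrees p =
      trans (↭.↭-length p) (trans (length-++ upper) (cong₂ _+_ (length-map _ δ₁) (length-map _ δ₂))) ,
      trans (stat-↭ s p) (trans (stat-++ s upper lower)
                                (cong₂ _+_ (stat-upperBlock s δ₁ δ₂) (stat-lowerBlock s δ₁ δ₂)))

  length-shuffleProduct : ∀ δ₁ δ₂ →
    length (shuffleProduct δ₁ δ₂) * (size δ₁ !) * (size δ₂ !) ≡ (size δ₁ + size δ₂) !
  length-shuffleProduct δ₁ δ₂ =
    subst₂ (λ n₁ n₂ → length (shuffleProduct δ₁ δ₂) * (n₁ !) * (n₂ !) ≡ (n₁ + n₂) !)
           (length-map _ δ₁) (length-map _ δ₂)
           (length-shuffles (upperBlock δ₁ δ₂) (lowerBlock δ₁ δ₂))

module FieldLemmas {c ℓ : Level} (K : Field c ℓ) where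
  open Field K hiding (zero)
  open FieldOps K
  open import Relation.Binary.Reasoning.Setoid setoid
  import Algebra.Properties.Semiring.Mult semiring as Mult
  open import Algebra.Solver.CommutativeMonoid *-commutativeMonoid using (solve; _⊕_; _⊜_)

  fromℕ≈×1# : ∀ n → fromℕ n ≈ n Mult.× 1#
  fromℕ≈×1# zero    = refl
  fromℕ≈×1# (suc n) = +-cong refl (fromℕ≈×1# n)

  fromℕ-* : ∀ m n → fromℕ (m ℕ.* n) ≈ fromℕ m * fromℕ n
  fromℕ-* m n = begin
    fromℕ (m ℕ.* n)                ≈⟨ fromℕ≈×1# (m ℕ.* n) ⟩
    (m ℕ.* n) Mult.× 1#            ≈⟨ Mult.×1-homo-* m n ⟩
    (m Mult.× 1#) * (n Mult.× 1#)  ≈⟨ sym (*-cong (fromℕ≈×1# m) (fromℕ≈×1# n)) ⟩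
    fromℕ m * fromℕ n              ∎

  fromℕ-≉0 : CharZero → ∀ {n} → 1 ℕ.≤ n → ¬ fromℕ n ≈ 0#
  fromℕ-≉0 charZero {suc n} (s≤s _) = charZero n

  ⁻¹-≈1# : ∀ {x} → x ≈ 1# → x ⁻¹ ≈ 1#
  ⁻¹-≈1# {x} x≈1 = begin
    x ⁻¹        ≈⟨ sym (*-identityˡ _) ⟩
    1# * x ⁻¹   ≈⟨ *-cong (sym x≈1) refl ⟩
    x * x ⁻¹    ≈⟨ ⁻¹-inverse x (λ x≈0 → 1≉0 (trans (sym x≈1) x≈0)) ⟩
    1#          ∎

  ⁻¹-split : ∀ {w x y z} a b → ¬ x ≈ 0# → ¬ y ≈ 0# → ¬ z ≈ 0# →
             w * x * y ≈ z → w * ((a * b) * z ⁻¹) ≈ (a * x ⁻¹) * (b * y ⁻¹)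
  ⁻¹-split {w} {x} {y} {z} a b x≉0 y≉0 z≉0 wxy≈z = begin
    w * ((a * b) * z ⁻¹)                                ≈⟨ sym (trans (*-cong refl units) (*-identityʳ _)) ⟩
    w * ((a * b) * z ⁻¹) * ((x * x ⁻¹) * (y * y ⁻¹))
      ≈⟨ solve 8 (λ w x y z′ x′ y′ a b →
                    (w ⊕ ((a ⊕ b) ⊕ z′)) ⊕ ((x ⊕ x′) ⊕ (y ⊕ y′)) ⊜ (((w ⊕ x) ⊕ y) ⊕ z′) ⊕ ((a ⊕ x′) ⊕ (b ⊕ y′)))
               refl w x y (z ⁻¹) (x ⁻¹) (y ⁻¹) a b ⟩
    (w * x * y) * z ⁻¹ * ((a * x ⁻¹) * (b * y ⁻¹))      ≈⟨ *-cong (trans (*-cong wxy≈z refl) (⁻¹-inverse z z≉0)) refl ⟩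
    1# * ((a * x ⁻¹) * (b * y ⁻¹))                      ≈⟨ *-identityˡ _ ⟩
    (a * x ⁻¹) * (b * y ⁻¹)                             ∎
    where
    units : (x * x ⁻¹) * (y * y ⁻¹) ≈ 1#
    units = trans (*-cong (⁻¹-inverse x x≉0) (⁻¹-inverse y y≉0)) (*-identityˡ 1#)

module PolynomialLaws {c ℓ : Level} (K : Field c ℓ) where
  open Field K hiding (zero)
  open FieldOps K
  module ≈-Reasoning = SetoidReasoning setoid
  open import Algebra.Properties.CommutativeSemigroup +-commutativeSemigroup using (interchange)

  coeff : Poly → ℕ → Carrier
  coeff []      i       = 0#
  coeff (a ∷ p) zero    = a
  coeff (a ∷ p) (suc i) = coeff p i

  infix 4 _≗_
  record _≗_ (p r : Poly) : Set ℓ where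
    constructor coeffwise
    field coeff-≈ : ∀ i → coeff p i ≈ coeff r i
  open _≗_ public

  ≗-setoid : Setoid c ℓ
  ≗-setoid = record
    { Carrier       = Poly
    ; _≈_           = _≗_
    ; isEquivalence = record
      { refl  = coeffwise λ i → refl
      ; sym   = λ p≗r → coeffwise λ i → sym (coeff-≈ p≗r i)
      ; trans = λ p≗r r≗u → coeffwise λ i → trans (coeff-≈ p≗r i) (coeff-≈ r≗u i)
      }
    }

  open Setoid ≗-setoid public using () renaming (refl to ≗-refl; sym to ≗-sym; trans to ≗-trans)
  module ≗-Reasoning = SetoidReasoning ≗-setoid

  ≗-[]⇒IsZeroP : ∀ {p} → p ≗ [] → IsZeroP p
  ≗-[]⇒IsZeroP {[]}    p≗[] = []
  ≗-[]⇒IsZeroP {a ∷ p} p≗[] = coeff-≈ p≗[] zero ∷ ≗-[]⇒IsZeroP (coeffwise λ i → coeff-≈ p≗[] (suc i))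

  ≗⇒≈ₚ : ∀ {p r} → p ≗ r → p ≈ₚ r
  ≗⇒≈ₚ {[]}    {r}     p≗r = ≗-[]⇒IsZeroP (≗-sym p≗r)
  ≗⇒≈ₚ {a ∷ p} {[]}    p≗r = coeff-≈ p≗r zero , ≗-[]⇒IsZeroP (coeffwise λ i → coeff-≈ p≗r (suc i))
  ≗⇒≈ₚ {a ∷ p} {b ∷ r} p≗r = coeff-≈ p≗r zero , ≗⇒≈ₚ (coeffwise λ i → coeff-≈ p≗r (suc i))

  coeff-+ₚ : ∀ p r i → coeff (p +ₚ r) i ≈ coeff p i + coeff r i
  coeff-+ₚ []      r       i       = sym (+-identityˡ _)
  coeff-+ₚ (a ∷ p) []      i       = sym (+-identityʳ _)
  coeff-+ₚ (a ∷ p) (b ∷ r) zero    = refl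
  coeff-+ₚ (a ∷ p) (b ∷ r) (suc i) = coeff-+ₚ p r i

  coeff-·ₚ : ∀ a p i → coeff (a ·ₚ p) i ≈ a * coeff p i
  coeff-·ₚ a []      i       = sym (zeroʳ a)
  coeff-·ₚ a (b ∷ p) zero    = refl
  coeff-·ₚ a (b ∷ p) (suc i) = coeff-·ₚ a p i

  ∷-cong : ∀ {a b p r} → a ≈ b → p ≗ r → a ∷ p ≗ b ∷ r
  ∷-cong a≈b p≗r = coeffwise λ { zero → a≈b ; (suc i) → coeff-≈ p≗r i }

  0∷[]≗[] : 0# ∷ [] ≗ []
  0∷[]≗[] = coeffwise λ { zero → refl ; (suc i) → refl }

  +ₚ-cong : ∀ {p p′ r r′} → p ≗ p′ → r ≗ r′ → p +ₚ r ≗ p′ +ₚ r′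
  +ₚ-cong {p} {p′} {r} {r′} p≗p′ r≗r′ = coeffwise λ i → begin
    coeff (p +ₚ r) i           ≈⟨ coeff-+ₚ p r i ⟩
    coeff p i + coeff r i      ≈⟨ +-cong (coeff-≈ p≗p′ i) (coeff-≈ r≗r′ i) ⟩
    coeff p′ i + coeff r′ i    ≈⟨ coeff-+ₚ p′ r′ i ⟨
    coeff (p′ +ₚ r′) i         ∎
    where open ≈-Reasoning

  +ₚ-assoc : ∀ p r u → (p +ₚ r) +ₚ u ≗ p +ₚ (r +ₚ u)
  +ₚ-assoc p r u = coeffwise λ i → begin
    coeff ((p +ₚ r) +ₚ u) i                 ≈⟨ trans (coeff-+ₚ (p +ₚ r) u i) (+-cong (coeff-+ₚ p r i) refl) ⟩
    (coeff p i + coeff r i) + coeff u i     ≈⟨ +-assoc _ _ _ ⟩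
    coeff p i + (coeff r i + coeff u i)     ≈⟨ trans (coeff-+ₚ p (r +ₚ u) i) (+-cong refl (coeff-+ₚ r u i)) ⟨
    coeff (p +ₚ (r +ₚ u)) i                 ∎
    where open ≈-Reasoning

  +ₚ-identityʳ : ∀ p → p +ₚ [] ≗ p
  +ₚ-identityʳ []      = ≗-refl
  +ₚ-identityʳ (a ∷ p) = ≗-refl

  +ₚ-interchange : ∀ p r u v → (p +ₚ r) +ₚ (u +ₚ v) ≗ (p +ₚ u) +ₚ (r +ₚ v)
  +ₚ-interchange p r u v = coeffwise λ i → begin
    coeff ((p +ₚ r) +ₚ (u +ₚ v)) i
      ≈⟨ trans (coeff-+ₚ (p +ₚ r) (u +ₚ v) i) (+-cong (coeff-+ₚ p r i) (coeff-+ₚ u v i)) ⟩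
    (coeff p i + coeff r i) + (coeff u i + coeff v i)
      ≈⟨ interchange _ _ _ _ ⟩
    (coeff p i + coeff u i) + (coeff r i + coeff v i)
      ≈⟨ trans (coeff-+ₚ (p +ₚ u) (r +ₚ v) i) (+-cong (coeff-+ₚ p u i) (coeff-+ₚ r v i)) ⟨
    coeff ((p +ₚ u) +ₚ (r +ₚ v)) i
      ∎
    where open ≈-Reasoning

  0∷-+ₚ : ∀ p r → 0# ∷ (p +ₚ r) ≗ (0# ∷ p) +ₚ (0# ∷ r)
  0∷-+ₚ p r = ∷-cong (sym (+-identityʳ 0#)) ≗-refl

  ·ₚ-congʳ : ∀ {a b} p → a ≈ b → a ·ₚ p ≗ b ·ₚ p
  ·ₚ-congʳ {a} {b} p a≈b = coeffwise λ i →
    trans (coeff-·ₚ a p i) (trans (*-cong a≈b refl) (sym (coeff-·ₚ b p i)))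

  ·ₚ-zeroˡ : ∀ p → 0# ·ₚ p ≗ []
  ·ₚ-zeroˡ p = coeffwise λ i → trans (coeff-·ₚ 0# p i) (zeroˡ _)

  ·ₚ-assoc : ∀ a b p → a ·ₚ (b ·ₚ p) ≗ (a * b) ·ₚ p
  ·ₚ-assoc a b p = coeffwise λ i → begin
    coeff (a ·ₚ (b ·ₚ p)) i    ≈⟨ trans (coeff-·ₚ a (b ·ₚ p) i) (*-cong refl (coeff-·ₚ b p i)) ⟩
    a * (b * coeff p i)        ≈⟨ *-assoc a b _ ⟨
    (a * b) * coeff p i        ≈⟨ coeff-·ₚ (a * b) p i ⟨
    coeff ((a * b) ·ₚ p) i     ∎
    where open ≈-Reasoning

  ·ₚ-distribˡ : ∀ a p r → a ·ₚ (p +ₚ r) ≗ a ·ₚ p +ₚ a ·ₚ r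
  ·ₚ-distribˡ a p r = coeffwise λ i → begin
    coeff (a ·ₚ (p +ₚ r)) i            ≈⟨ trans (coeff-·ₚ a (p +ₚ r) i) (*-cong refl (coeff-+ₚ p r i)) ⟩
    a * (coeff p i + coeff r i)        ≈⟨ distribˡ a _ _ ⟩
    a * coeff p i + a * coeff r i      ≈⟨ trans (coeff-+ₚ (a ·ₚ p) (a ·ₚ r) i) (+-cong (coeff-·ₚ a p i) (coeff-·ₚ a r i)) ⟨
    coeff (a ·ₚ p +ₚ a ·ₚ r) i         ∎
    where open ≈-Reasoning

  ·ₚ-distribʳ : ∀ a b p → (a + b) ·ₚ p ≗ a ·ₚ p +ₚ b ·ₚ p
  ·ₚ-distribʳ a b p = coeffwise λ i → begin
    coeff ((a + b) ·ₚ p) i             ≈⟨ coeff-·ₚ (a + b) p i ⟩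
    (a + b) * coeff p i                ≈⟨ distribʳ _ a b ⟩
    a * coeff p i + b * coeff p i      ≈⟨ trans (coeff-+ₚ (a ·ₚ p) (b ·ₚ p) i) (+-cong (coeff-·ₚ a p i) (coeff-·ₚ b p i)) ⟨
    coeff (a ·ₚ p +ₚ b ·ₚ p) i         ∎
    where open ≈-Reasoning

  *ₚ-zeroʳ : ∀ p → p *ₚ [] ≗ []
  *ₚ-zeroʳ []      = ≗-refl
  *ₚ-zeroʳ (a ∷ p) = ≗-trans (∷-cong refl (*ₚ-zeroʳ p)) 0∷[]≗[]

  *ₚ-distribˡ : ∀ p r u → p *ₚ (r +ₚ u) ≗ p *ₚ r +ₚ p *ₚ u
  *ₚ-distribˡ []      r u = ≗-refl
  *ₚ-distribˡ (a ∷ p) r u = begin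
    a ·ₚ (r +ₚ u) +ₚ (0# ∷ p *ₚ (r +ₚ u))
      ≈⟨ +ₚ-cong (·ₚ-distribˡ a r u) (≗-trans (∷-cong refl (*ₚ-distribˡ p r u)) (0∷-+ₚ (p *ₚ r) (p *ₚ u))) ⟩
    (a ·ₚ r +ₚ a ·ₚ u) +ₚ ((0# ∷ p *ₚ r) +ₚ (0# ∷ p *ₚ u))
      ≈⟨ +ₚ-interchange (a ·ₚ r) (a ·ₚ u) (0# ∷ p *ₚ r) (0# ∷ p *ₚ u) ⟩
    (a ·ₚ r +ₚ (0# ∷ p *ₚ r)) +ₚ (a ·ₚ u +ₚ (0# ∷ p *ₚ u))
      ∎
    where open ≗-Reasoning

  *ₚ-distribʳ : ∀ p r u → (p +ₚ r) *ₚ u ≗ p *ₚ u +ₚ r *ₚ u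
  *ₚ-distribʳ []      r       u = ≗-refl
  *ₚ-distribʳ (a ∷ p) []      u = ≗-sym (+ₚ-identityʳ ((a ∷ p) *ₚ u))
  *ₚ-distribʳ (a ∷ p) (b ∷ r) u = begin
    (a + b) ·ₚ u +ₚ (0# ∷ (p +ₚ r) *ₚ u)
      ≈⟨ +ₚ-cong (·ₚ-distribʳ a b u) (≗-trans (∷-cong refl (*ₚ-distribʳ p r u)) (0∷-+ₚ (p *ₚ u) (r *ₚ u))) ⟩
    (a ·ₚ u +ₚ b ·ₚ u) +ₚ ((0# ∷ p *ₚ u) +ₚ (0# ∷ r *ₚ u))
      ≈⟨ +ₚ-interchange (a ·ₚ u) (b ·ₚ u) (0# ∷ p *ₚ u) (0# ∷ r *ₚ u) ⟩
    (a ·ₚ u +ₚ (0# ∷ p *ₚ u)) +ₚ (b ·ₚ u +ₚ (0# ∷ r *ₚ u))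
      ∎
    where open ≗-Reasoning

  ·qPow-*ₚ-·qPow : ∀ a b i j → (a ·ₚ qPow i) *ₚ (b ·ₚ qPow j) ≗ (a * b) ·ₚ qPow (i ℕ.+ j)
  ·qPow-*ₚ-·qPow a b zero j = begin
    (a * 1#) ·ₚ (b ·ₚ qPow j) +ₚ (0# ∷ [])   ≈⟨ +ₚ-cong (·ₚ-congʳ (b ·ₚ qPow j) (*-identityʳ a)) 0∷[]≗[] ⟩
    a ·ₚ (b ·ₚ qPow j) +ₚ []                 ≈⟨ +ₚ-identityʳ _ ⟩
    a ·ₚ (b ·ₚ qPow j)                       ≈⟨ ·ₚ-assoc a b (qPow j) ⟩
    (a * b) ·ₚ qPow j                        ∎
    where open ≗-Reasoning
  ·qPow-*ₚ-·qPow a b (suc i) j = begin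
    (a * 0#) ·ₚ (b ·ₚ qPow j) +ₚ (0# ∷ (a ·ₚ qPow i) *ₚ (b ·ₚ qPow j))
      ≈⟨ +ₚ-cong (≗-trans (·ₚ-congʳ (b ·ₚ qPow j) (zeroʳ a)) (·ₚ-zeroˡ _)) ≗-refl ⟩
    0# ∷ (a ·ₚ qPow i) *ₚ (b ·ₚ qPow j)
      ≈⟨ ∷-cong (sym (zeroʳ (a * b))) (·qPow-*ₚ-·qPow a b i j) ⟩
    (a * b) * 0# ∷ (a * b) ·ₚ qPow (i ℕ.+ j)
      ∎
    where open ≗-Reasoning

module Morphism {c ℓ : Level} (K : Field c ℓ) (s : Stat) where
  open Field K hiding (zero)
  open FieldOps K
  open ASMAlgebra K
  open FieldLemmas K
  open PolynomialLaws K
  open ShuffleProduct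
  open ≗-Reasoning

  term : Carrier → Mat → Poly
  term a δ = (a * (fromℕ (size δ !) ⁻¹)) ·ₚ qPow (stat s δ)

  φ-++ : ∀ x y → φ s (x ++ y) ≗ φ s x +ₚ φ s y
  φ-++ []            y = ≗-refl
  φ-++ ((a , δ) ∷ x) y = begin
    term a δ +ₚ φ s (x ++ y)        ≈⟨ +ₚ-cong ≗-refl (φ-++ x y) ⟩
    term a δ +ₚ (φ s x +ₚ φ s y)    ≈⟨ +ₚ-assoc (term a δ) (φ s x) (φ s y) ⟨
    (term a δ +ₚ φ s x) +ₚ φ s y    ∎

  φ-concatMap-distribʳ : ∀ (f : Carrier × Mat → Comb) r → (∀ a δ → φ s (f (a , δ)) ≗ term a δ *ₚ r) →
                         ∀ x → φ s (concatMap f x) ≗ φ s x *ₚ r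
  φ-concatMap-distribʳ f r f≗ []            = ≗-refl
  φ-concatMap-distribʳ f r f≗ ((a , δ) ∷ x) = begin
    φ s (f (a , δ) ++ concatMap f x)          ≈⟨ φ-++ (f (a , δ)) (concatMap f x) ⟩
    φ s (f (a , δ)) +ₚ φ s (concatMap f x)    ≈⟨ +ₚ-cong (f≗ a δ) (φ-concatMap-distribʳ f r f≗ x) ⟩
    term a δ *ₚ r +ₚ φ s x *ₚ r               ≈⟨ *ₚ-distribʳ (term a δ) (φ s x) r ⟨
    (term a δ +ₚ φ s x) *ₚ r                  ∎

  φ-concatMap-distribˡ : ∀ (f : Carrier × Mat → Comb) p → (∀ b δ → φ s (f (b , δ)) ≗ p *ₚ term b δ) →
                         ∀ y → φ s (concatMap f y) ≗ p *ₚ φ s y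
  φ-concatMap-distribˡ f p f≗ []            = ≗-sym (*ₚ-zeroʳ p)
  φ-concatMap-distribˡ f p f≗ ((b , δ) ∷ y) = begin
    φ s (f (b , δ) ++ concatMap f y)          ≈⟨ φ-++ (f (b , δ)) (concatMap f y) ⟩
    φ s (f (b , δ)) +ₚ φ s (concatMap f y)    ≈⟨ +ₚ-cong (f≗ b δ) (φ-concatMap-distribˡ f p f≗ y) ⟩
    p *ₚ term b δ +ₚ p *ₚ φ s y               ≈⟨ *ₚ-distribˡ p (term b δ) (φ s y) ⟨
    p *ₚ (term b δ +ₚ φ s y)                  ∎

  φ-homogeneous : ∀ e n k Ms → All (λ M → size M ≡ n × stat s M ≡ k) Ms →
    φ s (map (e ,_) Ms) ≗ (fromℕ (length Ms) * (e * (fromℕ (n !) ⁻¹))) ·ₚ qPow k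
  φ-homogeneous e n k []       []                  =
    ≗-sym (≗-trans (·ₚ-congʳ (qPow k) (zeroˡ _)) (·ₚ-zeroˡ (qPow k)))
  φ-homogeneous e n k (M ∷ Ms) ((≡.refl , ≡.refl) ∷ Ms-homogeneous) = begin
    x ·ₚ qPow k +ₚ φ s (map (e ,_) Ms)            ≈⟨ +ₚ-cong ≗-refl (φ-homogeneous e n k Ms Ms-homogeneous) ⟩
    x ·ₚ qPow k +ₚ (fromℕ (length Ms) * x) ·ₚ qPow k
      ≈⟨ ·ₚ-distribʳ x (fromℕ (length Ms) * x) (qPow k) ⟨
    (x + fromℕ (length Ms) * x) ·ₚ qPow k
      ≈⟨ ·ₚ-congʳ (qPow k) (trans (+-cong (sym (*-identityˡ x)) refl) (sym (distribʳ x 1# _))) ⟩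
    ((1# + fromℕ (length Ms)) * x) ·ₚ qPow k      ∎
    where
    x : Carrier
    x = e * (fromℕ (size M !) ⁻¹)

  φ-shuffleProduct : CharZero → ∀ a b δ₁ δ₂ →
    φ s (map (a * b ,_) (shuffleProduct δ₁ δ₂)) ≗ term a δ₁ *ₚ term b δ₂
  φ-shuffleProduct charZero a b δ₁ δ₂ = begin
    φ s (map (a * b ,_) (shuffleProduct δ₁ δ₂))
      ≈⟨ φ-homogeneous (a * b) (n₁ ℕ.+ n₂) (k₁ ℕ.+ k₂) _ (shuffleProduct-homogeneous s δ₁ δ₂) ⟩
    (fromℕ N * ((a * b) * F ⁻¹)) ·ₚ qPow (k₁ ℕ.+ k₂)
      ≈⟨ ·ₚ-congʳ (qPow (k₁ ℕ.+ k₂)) coefficient ⟩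
    ((a * F₁ ⁻¹) * (b * F₂ ⁻¹)) ·ₚ qPow (k₁ ℕ.+ k₂)
      ≈⟨ ·qPow-*ₚ-·qPow (a * F₁ ⁻¹) (b * F₂ ⁻¹) k₁ k₂ ⟨
    term a δ₁ *ₚ term b δ₂
      ∎
    where
    n₁ n₂ k₁ k₂ N : ℕ
    n₁ = size δ₁
    n₂ = size δ₂
    k₁ = stat s δ₁
    k₂ = stat s δ₂
    N  = length (shuffleProduct δ₁ δ₂)
    F₁ F₂ F : Carrier
    F₁ = fromℕ (n₁ !)
    F₂ = fromℕ (n₂ !)
    F  = fromℕ ((n₁ ℕ.+ n₂) !)

    factorials : fromℕ N * F₁ * F₂ ≈ F
    factorials = trans (sym (trans (fromℕ-* (N ℕ.* (n₁ !)) (n₂ !)) (*-cong (fromℕ-* N (n₁ !)) refl)))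
                       (reflexive (≡.cong fromℕ (length-shuffleProduct δ₁ δ₂)))

    coefficient : fromℕ N * ((a * b) * F ⁻¹) ≈ (a * F₁ ⁻¹) * (b * F₂ ⁻¹)
    coefficient = ⁻¹-split a b (factorial≉0 n₁) (factorial≉0 n₂) (factorial≉0 (n₁ ℕ.+ n₂)) factorials
      where
      factorial≉0 : ∀ n → ¬ fromℕ (n !) ≈ 0#
      factorial≉0 n = fromℕ-≉0 charZero (ℕ.1≤n! n)

  φ-·A : CharZero → ∀ x y → φ s (x ·A y) ≗ φ s x *ₚ φ s y
  φ-·A charZero x y =
    φ-concatMap-distribʳ _ (φ s y)
      (λ a δ₁ → φ-concatMap-distribˡ _ (term a δ₁) (λ b δ₂ → φ-shuffleProduct charZero a b δ₁ δ₂) y)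
      x

  -- stat s [] is stuck on s; stat-sum s [] computes it to 0.
  φ-unitA : φ s unitA ≈ₚ oneₚ
  φ-unitA rewrite stat-sum s [] = trans (*-identityʳ _) (trans (*-identityˡ _) (⁻¹-≈1# (+-identityʳ 1#))) , []

proposition4p3 : {c ℓ : Level} (K : Field c ℓ) → FieldOps.CharZero K → (s : Stat)
    → ((x y : ASMAlgebra.Comb K) → ASMAlgebra.AllASM K x → ASMAlgebra.AllASM K y
        → FieldOps._≈ₚ_ K (ASMAlgebra.φ K s (ASMAlgebra._·A_ K x y))
            (FieldOps._*ₚ_ K (ASMAlgebra.φ K s x) (ASMAlgebra.φ K s y)))
    × FieldOps._≈ₚ_ K (ASMAlgebra.φ K s (ASMAlgebra.unitA K)) (FieldOps.oneₚ K)
proposition4p3 K charZero s =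
  (λ x y _ _ → PolynomialLaws.≗⇒≈ₚ K (Morphism.φ-·A K s charZero x y)) , Morphism.φ-unitA K s
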